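{- Let $M$ be a matrix over a field indexed by $\mathbb{Z}\times\mathbb{Z}$, and let $r$ be a positive integer. Suppose that all contiguous minors of $M$ of size $(r+1)\times(r+1)$ vanish, and that none of the contiguous $r\times r$ minors of $M$ whose row index interval equals its column index interval vanishes. Then no contiguous $r\times r$ minor of $M$ vanishes at all; consequently $M$ has rank at most $r$ and all $(r+1)\times(r+1)$ minors of $M$ vanish.
   Context: A minor of $M$ is contiguous if its rows form an interval of consecutive integers and its columns form an interval of consecutive integers. -}

module Defs where

open import Level using (Level; _⊔_) renaming (suc to lsuc)
open import Data.Nat using (ℕ; zero; suc)
open import Data.Fin using (Fin; zero; suc; toℕ; punchIn)
import Data.Fin as Fin
open import Data.Integer using (ℤ; +_) renaming (_+_ to _+ℤ_; _<_ to _<ℤ_)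
open import Data.Product using (Σ)
open import Relation.Nullary using (¬_)
open import Algebra.Bundles using (CommutativeRing)

record Field (c ℓ : Level) : Set (lsuc (c ⊔ ℓ)) where
  field
    commutativeRing : CommutativeRing c ℓ
  open CommutativeRing commutativeRing public
  field
    0≉1     : ¬ (0# ≈ 1#)
    inverse : ∀ x → ¬ (x ≈ 0#) → Σ Carrier (λ y → x * y ≈ 1#)

module _ {c ℓ : Level} (K : Field c ℓ) where
  open Field K using (Carrier; _≈_; 0#; 1#; _*_; _-_; _+_)

  altSum : ∀ {n} → (Fin n → Carrier) → Carrier
  altSum {zero}  f = 0#
  altSum {suc n} f = f zero - altSum (λ i → f (suc i))

  det : ∀ {n} → (Fin n → Fin n → Carrier) → Carrier
  det {zero}  A = 1#
  det {suc n} A =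
    altSum (λ i → A i zero * det (λ a b → A (punchIn i a) (suc b)))

  ZMatrix : Set c
  ZMatrix = ℤ → ℤ → Carrier

  StrictlyIncreasing : ∀ {k} → (Fin k → ℤ) → Set
  StrictlyIncreasing {k} ρ = ∀ (a b : Fin k) → a Fin.< b → ρ a <ℤ ρ b

  minor : ZMatrix → ∀ {k} → (Fin k → ℤ) → (Fin k → ℤ) → Carrier
  minor M ρ σ = det (λ a b → M (ρ a) (σ b))

  interval : ∀ k → ℤ → Fin k → ℤ
  interval k i a = i +ℤ (+ toℕ a)

  contiguousMinor : ZMatrix → ℕ → ℤ → ℤ → Carrier
  contiguousMinor M k i j = minor M (interval k i) (interval k j)

  sumFin : ∀ {n} → (Fin n → Carrier) → Carrier
  sumFin {zero}  f = 0#
  sumFin {suc n} f = f zero + sumFin (λ i → f (suc i))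

  RankAtMost : ZMatrix → ℕ → Set (c ⊔ ℓ)
  RankAtMost M r =
    Σ (Fin r → ℤ → Carrier) λ u →
      ∀ (i : ℤ) → Σ (Fin r → Carrier) λ coeff →
        ∀ (j : ℤ) → M i j ≈ sumFin (λ k → coeff k * u k j)

-- Write D(i,j) for the contiguous r×r minor on rows i..i+r-1 and columns j..j+r-1. The signed cofactors
-- of the first column of the (r+1)×(r+1) window at (i,j) form a vector annihilating every column of that
-- window, since the window is singular and any other column gives a matrix with a repeated column; its
-- first and last entries are D(i+1,j+1) and ±D(i,j+1). If D(i,j) ≠ 0, the left kernel of rows i..i+r
-- restricted to columns j..j+r-1 is a line, so the cofactor vectors of the windows at columns j-1 and j
-- are proportional, which yields D(i,j) D(i+1,j+1) = D(i,j+1) D(i+1,j). Starting from the diagonal this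
-- makes every D(i,j) nonzero. The same proportionality pushes the relation among rows i..i+r from one
-- window of columns to the next, so it holds on all columns; as both end coefficients are nonzero, every
-- row is a combination of the r rows on either side of it, hence of rows 0..r-1.
module Submission where

open import Defs using (Field; ZMatrix; interval; contiguousMinor; minor; StrictlyIncreasing; RankAtMost)
import Defs
open import Level using (Level; _⊔_)
open import Data.Nat using (ℕ; zero; suc; _≤_)
open import Data.Integer using (ℤ; +_; -[1+_]) renaming (_+_ to _+ℤ_; _-_ to _-ℤ_)
open import Data.Integer.Tactic.RingSolver using (solve-∀)
open import Data.Fin using (Fin; zero; suc)
open import Data.Product using (_×_)
open import Relation.Nullary using (¬_)

open import Function using (_∘_)
import Data.Nat as ℕ
import Data.Nat.Properties as ℕ
import Data.Integer as Int
import Data.Integer.Properties as Int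
import Data.Fin as Fin
import Data.Fin.Properties as Fin
open import Data.Maybe using (Maybe; just; nothing)
open import Data.Product using (Σ; _,_; proj₁; proj₂)
open import Relation.Nullary using (yes; no; contradiction)
open import Data.Sum using (_⊎_; inj₁; inj₂)
open import Relation.Binary.Definitions using (tri<; tri≈; tri>)
open import Relation.Binary.PropositionalEquality as ≡ using (_≡_; _≢_)
open import Algebra.Bundles using (CommutativeRing)
open import Data.Vec.Functional using (updateAt; _∷_)
open import Data.Vec.Functional.Properties using (updateAt-updates; updateAt-minimal; updateAt-updateAt; updateAt-id-local)

-- Algebra.Solver.Ring needs coefficients with (semi-)decidable equality; ℤ maps into every commutative ring.
module ℤ-Coefficients {c ℓ} (R : CommutativeRing c ℓ) where
  open CommutativeRing R
  open import Algebra.Properties.Ring ring using (-0#≈0#; -‿involutive; -‿distribˡ-*; -‿distribʳ-*; -‿+-comm)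
  open import Algebra.Properties.Semiring.Mult.TCOptimised semiring using (1+×; ×-homo-+; ×1-homo-*)
    renaming (_×_ to _×′_)
  open import Algebra.Solver.Ring.AlmostCommutativeRing
    using (fromCommutativeRing; _-Raw-AlmostCommutative⟶_)
  open import Algebra.Properties.CommutativeSemigroup +-commutativeSemigroup using (interchange)
  open import Relation.Binary.Reasoning.Setoid setoid
  open import Data.Integer using (_⊖_)

  ⟦_⟧ : ℤ → Carrier
  ⟦ + n ⟧      = n ×′ 1#
  ⟦ -[1+ n ] ⟧ = - (suc n ×′ 1#)

  ⟦-⟧ : ∀ i → ⟦ Int.- i ⟧ ≈ - ⟦ i ⟧
  ⟦-⟧ (+ zero) = sym -0#≈0#
  ⟦-⟧ (+ suc n)  = refl
  ⟦-⟧ -[1+ n ]   = sym (-‿involutive _)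

  ⟦⊖⟧ : ∀ m n → ⟦ m ⊖ n ⟧ ≈ m ×′ 1# - n ×′ 1#
  ⟦⊖⟧ m        zero  = sym (trans (+-congˡ -0#≈0#) (+-identityʳ _))
  ⟦⊖⟧ zero   (suc n) = sym (+-identityˡ _)
  ⟦⊖⟧ (suc m)  (suc n) = begin
    ⟦ suc m ⊖ suc n ⟧                  ≡⟨ ≡.cong ⟦_⟧ (Int.[1+m]⊖[1+n]≡m⊖n m n) ⟩
    ⟦ m ⊖ n ⟧                          ≈⟨ ⟦⊖⟧ m n ⟩
    a - b                              ≈⟨ +-identityˡ (a - b) ⟨
    0# + (a - b)                       ≈⟨ +-congʳ (-‿inverseʳ 1#) ⟨
    (1# - 1#) + (a - b)                ≈⟨ interchange 1# (- 1#) a (- b) ⟩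
    (1# + a) + (- 1# - b)              ≈⟨ +-congˡ (-‿+-comm 1# b) ⟩
    (1# + a) - (1# + b)                ≈⟨ +-cong (1+× m 1#) (-‿cong (1+× n 1#)) ⟨
    suc m ×′ 1# - suc n ×′ 1#          ∎
    where a = m ×′ 1#; b = n ×′ 1#

  ⟦+⟧ : ∀ i j → ⟦ i Int.+ j ⟧ ≈ ⟦ i ⟧ + ⟦ j ⟧
  ⟦+⟧ -[1+ m ] -[1+ n ] = begin
    - (suc (suc (m ℕ.+ n)) ×′ 1#)      ≡⟨ ≡.cong (λ k → - (suc k ×′ 1#)) (ℕ.+-suc m n) ⟨
    - ((suc m ℕ.+ suc n) ×′ 1#)        ≈⟨ -‿cong (×-homo-+ 1# (suc m) (suc n)) ⟩
    - (suc m ×′ 1# + suc n ×′ 1#)      ≈⟨ -‿+-comm _ _ ⟨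
    - (suc m ×′ 1#) + - (suc n ×′ 1#)  ∎
  ⟦+⟧ -[1+ m ] (+ n)    = trans (⟦⊖⟧ n (suc m)) (+-comm _ _)
  ⟦+⟧ (+ m)    -[1+ n ] = ⟦⊖⟧ m (suc n)
  ⟦+⟧ (+ m)    (+ n)    = ×-homo-+ 1# m n

  ⟦+*⟧ : ∀ m j → ⟦ + m Int.* j ⟧ ≈ ⟦ + m ⟧ * ⟦ j ⟧
  ⟦+*⟧ m (+ n) = begin
    ⟦ + m Int.* + n ⟧     ≡⟨ ≡.cong ⟦_⟧ (Int.pos-* m n) ⟨
    (m ℕ.* n) ×′ 1#       ≈⟨ ×1-homo-* m n ⟩
    m ×′ 1# * (n ×′ 1#)   ∎
  ⟦+*⟧ m -[1+ n ] = begin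
    ⟦ + m Int.* Int.- + suc n ⟧     ≡⟨ ≡.cong ⟦_⟧ (Int.neg-distribʳ-* (+ m) (+ suc n)) ⟨
    ⟦ Int.- (+ m Int.* + suc n) ⟧   ≈⟨ ⟦-⟧ (+ m Int.* + suc n) ⟩
    - ⟦ + m Int.* + suc n ⟧         ≈⟨ -‿cong (⟦+*⟧ m (+ suc n)) ⟩
    - (⟦ + m ⟧ * ⟦ + suc n ⟧)       ≈⟨ -‿distribʳ-* _ _ ⟩
    ⟦ + m ⟧ * - ⟦ + suc n ⟧         ∎

  ⟦*⟧ : ∀ i j → ⟦ i Int.* j ⟧ ≈ ⟦ i ⟧ * ⟦ j ⟧
  ⟦*⟧ (+ m)    j = ⟦+*⟧ m j
  ⟦*⟧ -[1+ m ] j = begin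
    ⟦ Int.- + suc m Int.* j ⟧       ≡⟨ ≡.cong ⟦_⟧ (Int.neg-distribˡ-* (+ suc m) j) ⟨
    ⟦ Int.- (+ suc m Int.* j) ⟧     ≈⟨ ⟦-⟧ (+ suc m Int.* j) ⟩
    - ⟦ + suc m Int.* j ⟧           ≈⟨ -‿cong (⟦+*⟧ (suc m) j) ⟩
    - (⟦ + suc m ⟧ * ⟦ j ⟧)         ≈⟨ -‿distribˡ-* _ _ ⟩
    - ⟦ + suc m ⟧ * ⟦ j ⟧           ∎

  homomorphism : Int.+-*-rawRing -Raw-AlmostCommutative⟶ fromCommutativeRing R
  homomorphism = record
    { ⟦_⟧ = ⟦_⟧ ; +-homo = ⟦+⟧ ; *-homo = ⟦*⟧ ; -‿homo = ⟦-⟧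
    ; 0-homo = refl ; 1-homo = refl }

  decideEqual : ∀ i j → Maybe (⟦ i ⟧ ≈ ⟦ j ⟧)
  decideEqual i j with i Int.≟ j
  ... | yes ≡.refl = just refl
  ... | no _       = nothing

  open import Algebra.Solver.Ring Int.+-*-rawRing (fromCommutativeRing R) homomorphism decideEqual public
    using (solve; _:=_; _:+_; _:*_; :-_; _:-_; con)

module LinearAlgebra {c ℓ} (K : Field c ℓ) where
  open Field K hiding (zero)
  open ℤ-Coefficients commutativeRing using (solve; _:=_; _:+_; _:*_; :-_; _:-_; con)
  open import Algebra.Properties.Ring ring
    using (-‿involutive; -‿distribˡ-*; -‿distribʳ-*; -1*x≈-x; x[y-z]≈xy-xz; x∙y⁻¹≈ε⇒x≈y; x≈y⇒x∙y⁻¹≈ε; -0#≈0#)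
  open import Algebra.Properties.Semiring.Sum semiring
    using (sum; sum-cong-≋; ∑-distrib-+; ∑-comm; *-distribˡ-sum; *-distribʳ-sum;
           sum-init-last; sum-remove; sum-replicate-zero)
  open import Relation.Binary.Reasoning.Setoid setoid

  Matrix : ℕ → Set c
  Matrix n = Fin n → Fin n → Carrier

  altSum : ∀ {n} → (Fin n → Carrier) → Carrier
  altSum = Defs.altSum K

  det : ∀ {n} → Matrix n → Carrier
  det = Defs.det K

  x≉0∧x*y≈0⇒y≈0 : ∀ {x y} → ¬ x ≈ 0# → x * y ≈ 0# → y ≈ 0#
  x≉0∧x*y≈0⇒y≈0 {x} {y} x≉0 xy≈0 with inverse x x≉0
  ... | x⁻¹ , xx⁻¹≈1 = begin
    y                ≈⟨ *-identityˡ y ⟨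
    1# * y           ≈⟨ *-congʳ xx⁻¹≈1 ⟨
    (x * x⁻¹) * y    ≈⟨ solve 3 (λ x x⁻¹ y → (x :* x⁻¹) :* y := (x :* y) :* x⁻¹) refl x x⁻¹ y ⟩
    (x * y) * x⁻¹    ≈⟨ *-congʳ xy≈0 ⟩
    0# * x⁻¹         ≈⟨ zeroˡ x⁻¹ ⟩
    0#               ∎

  x≉0∧x*y≈x*z⇒y≈z : ∀ {x y z} → ¬ x ≈ 0# → x * y ≈ x * z → y ≈ z
  x≉0∧x*y≈x*z⇒y≈z {x} {y} {z} x≉0 xy≈xz =
    x∙y⁻¹≈ε⇒x≈y y z (x≉0∧x*y≈0⇒y≈0 x≉0 (trans (x[y-z]≈xy-xz x y z) (x≈y⇒x∙y⁻¹≈ε xy≈xz)))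

  x≉0∧y≉0⇒x*y≉0 : ∀ {x y} → ¬ x ≈ 0# → ¬ y ≈ 0# → ¬ x * y ≈ 0#
  x≉0∧y≉0⇒x*y≉0 x≉0 y≉0 xy≈0 = y≉0 (x≉0∧x*y≈0⇒y≈0 x≉0 xy≈0)

  x*y≉0⇒x≉0 : ∀ {x y} → ¬ x * y ≈ 0# → ¬ x ≈ 0#
  x*y≉0⇒x≉0 {y = y} xy≉0 x≈0 = xy≉0 (trans (*-congʳ x≈0) (zeroˡ y))

  x*y≉0⇒y≉0 : ∀ {x y} → ¬ x * y ≈ 0# → ¬ y ≈ 0#
  x*y≉0⇒y≉0 {x = x} xy≉0 y≈0 = xy≉0 (trans (*-congˡ y≈0) (zeroʳ x))

  sum-zero : ∀ {n} (f : Fin n → Carrier) → (∀ i → f i ≈ 0#) → sum f ≈ 0#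
  sum-zero {n} f f≈0 = trans (sum-cong-≋ f≈0) (sum-replicate-zero n)

  sum-linear : ∀ {n} x y (f g : Fin n → Carrier) →
               sum (λ i → x * f i + y * g i) ≈ x * sum f + y * sum g
  sum-linear x y f g = begin
    sum (λ i → x * f i + y * g i)                  ≈⟨ ∑-distrib-+ (λ i → x * f i) (λ i → y * g i) ⟩
    sum (λ i → x * f i) + sum (λ i → y * g i)      ≈⟨ +-cong (*-distribˡ-sum x f) (*-distribˡ-sum y g) ⟨
    x * sum f + y * sum g                          ∎

  sum-single : ∀ {n} (f : Fin n → Carrier) p → (∀ i → i ≢ p → f i ≈ 0#) → sum f ≈ f p
  sum-single {suc n} f p f≈0 = begin
    sum f                             ≈⟨ sum-remove {i = p} f ⟩
    f p + sum (f ∘ Fin.punchIn p)     ≈⟨ +-congˡ (sum-zero _ (λ i → f≈0 _ (Fin.punchInᵢ≢i p i))) ⟩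
    f p + 0#                          ≈⟨ +-identityʳ (f p) ⟩
    f p                               ∎

  sum≈sumFin : ∀ {n} (f : Fin n → Carrier) → sum f ≈ Defs.sumFin K f
  sum≈sumFin {zero}  f = refl
  sum≈sumFin {suc n} f = +-congˡ (sum≈sumFin (f ∘ Fin.suc))

  combination-trans : ∀ {m n} {C : Set} (x : C → Carrier) (Y : Fin m → C → Carrier) (U : Fin n → C → Carrier)
                      (e : Fin m → Carrier) (c : Fin m → Fin n → Carrier) →
                      (∀ col → x col ≈ sum (λ a → e a * Y a col)) →
                      (∀ a col → Y a col ≈ sum (λ k → c a k * U k col)) →
                      ∀ col → x col ≈ sum (λ k → sum (λ a → e a * c a k) * U k col)
  combination-trans x Y U e c x≈ Y≈ col = begin
    x col
      ≈⟨ x≈ col ⟩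
    sum (λ a → e a * Y a col)
      ≈⟨ sum-cong-≋ (λ a → *-congˡ (Y≈ a col)) ⟩
    sum (λ a → e a * sum (λ k → c a k * U k col))
      ≈⟨ sum-cong-≋ (λ a → *-distribˡ-sum (e a) (λ k → c a k * U k col)) ⟩
    sum (λ a → sum (λ k → e a * (c a k * U k col)))
      ≈⟨ ∑-comm (λ a k → e a * (c a k * U k col)) ⟩
    sum (λ k → sum (λ a → e a * (c a k * U k col)))
      ≈⟨ sum-cong-≋ (λ k → sum-cong-≋ (λ a → sym (*-assoc (e a) (c a k) (U k col)))) ⟩
    sum (λ k → sum (λ a → e a * c a k * U k col))
      ≈⟨ sum-cong-≋ (λ k → *-distribʳ-sum (U k col) (λ a → e a * c a k)) ⟨
    sum (λ k → sum (λ a → e a * c a k) * U k col) ∎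

  sign : ∀ {n} → Fin n → Carrier
  sign zero    = 1#
  sign (suc i) = - sign i

  sign*sign≈1 : ∀ {n} (i : Fin n) → sign i * sign i ≈ 1#
  sign*sign≈1 zero    = *-identityˡ 1#
  sign*sign≈1 (suc i) = trans (solve 1 (λ s → :- s :* :- s := s :* s) refl (sign i)) (sign*sign≈1 i)

  sign≉0 : ∀ {n} (i : Fin n) → ¬ sign i ≈ 0#
  sign≉0 i sᵢ≈0 = 0≉1 (trans (sym (trans (*-congʳ sᵢ≈0) (zeroˡ (sign i)))) (sign*sign≈1 i))

  altSum-cong : ∀ {n} {f g : Fin n → Carrier} → (∀ i → f i ≈ g i) → altSum f ≈ altSum g
  altSum-cong {zero}  f≈g = refl
  altSum-cong {suc n} f≈g = +-cong (f≈g zero) (-‿cong (altSum-cong (f≈g ∘ Fin.suc)))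

  altSum-linear : ∀ {n} x y (f g h : Fin n → Carrier) → (∀ i → f i ≈ x * g i + y * h i) →
                  altSum f ≈ x * altSum g + y * altSum h
  altSum-linear {zero} x y f g h _ =
    solve 2 (λ x y → con (+ 0) := x :* con (+ 0) :+ y :* con (+ 0)) refl x y
  altSum-linear {suc n} x y f g h f≈ = begin
    f zero - altSum (f ∘ Fin.suc)
      ≈⟨ +-cong (f≈ zero) (-‿cong (altSum-linear x y _ _ _ (f≈ ∘ Fin.suc))) ⟩
    (x * g₀ + y * h₀) - (x * altSum (g ∘ Fin.suc) + y * altSum (h ∘ Fin.suc))
      ≈⟨ solve 6 (λ x y a b c d → (x :* a :+ y :* b) :- (x :* c :+ y :* d) := x :* (a :- c) :+ y :* (b :- d))
               refl x y g₀ h₀ _ _ ⟩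
    x * (g₀ - altSum (g ∘ Fin.suc)) + y * (h₀ - altSum (h ∘ Fin.suc))   ∎
    where g₀ = g zero; h₀ = h zero

  altSum-zero : ∀ {n} (f : Fin n → Carrier) → (∀ i → f i ≈ 0#) → altSum f ≈ 0#
  altSum-zero {zero}  f _   = refl
  altSum-zero {suc n} f f≈0 =
    trans (+-cong (f≈0 zero) (-‿cong (altSum-zero (f ∘ Fin.suc) (f≈0 ∘ Fin.suc)))) (-‿inverseʳ 0#)

  altSum-distrib-+ : ∀ {n} (f g : Fin n → Carrier) → altSum (λ i → f i + g i) ≈ altSum f + altSum g
  altSum-distrib-+ f g =
    trans (altSum-linear 1# 1# _ f g (λ i → +-cong (sym (*-identityˡ (f i))) (sym (*-identityˡ (g i)))))
          (+-cong (*-identityˡ _) (*-identityˡ _))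

  *-distribˡ-altSum : ∀ {n} x (f : Fin n → Carrier) → x * altSum f ≈ altSum (λ i → x * f i)
  *-distribˡ-altSum {zero}  x f = zeroʳ x
  *-distribˡ-altSum {suc n} x f = begin
    x * (f zero - altSum (f ∘ Fin.suc))          ≈⟨ x[y-z]≈xy-xz x _ _ ⟩
    x * f zero - x * altSum (f ∘ Fin.suc)        ≈⟨ +-congˡ (-‿cong (*-distribˡ-altSum x (f ∘ Fin.suc))) ⟩
    x * f zero - altSum (λ i → x * f (suc i)) ∎

  altSum-neg : ∀ {n} (f g : Fin n → Carrier) → (∀ i → f i ≈ - g i) → altSum f ≈ - altSum g
  altSum-neg f g f≈-g = begin
    altSum f                     ≈⟨ altSum-cong (λ i → trans (f≈-g i) (sym (-1*x≈-x (g i)))) ⟩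
    altSum (λ i → - 1# * g i)    ≈⟨ *-distribˡ-altSum (- 1#) g ⟨
    - 1# * altSum g              ≈⟨ -1*x≈-x (altSum g) ⟩
    - altSum g                   ∎

  altSum≈sum-sign : ∀ {n} (f : Fin n → Carrier) → altSum f ≈ sum (λ i → sign i * f i)
  altSum≈sum-sign {zero}  f = refl
  altSum≈sum-sign {suc n} f = begin
    f zero - altSum (f ∘ Fin.suc)
      ≈⟨ +-cong (sym (*-identityˡ _)) (-‿cong (altSum≈sum-sign (f ∘ Fin.suc))) ⟩
    1# * f zero - sum (λ i → sign i * f (suc i))
      ≈⟨ +-congˡ (sym (-1*x≈-x _)) ⟩
    1# * f zero + - 1# * sum (λ i → sign i * f (suc i))
      ≈⟨ +-congˡ (*-distribˡ-sum (- 1#) (λ i → sign i * f (suc i))) ⟩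
    1# * f zero + sum (λ i → - 1# * (sign i * f (suc i)))
      ≈⟨ +-congˡ (sum-cong-≋ (λ i → trans (sym (*-assoc (- 1#) (sign i) (f (suc i))))
                                           (*-congʳ (-1*x≈-x (sign i))))) ⟩
    1# * f zero + sum (λ i → - sign i * f (suc i)) ∎

  swapAdjacent : ∀ {n} → Fin n → Fin (suc n) → Fin (suc n)
  swapAdjacent zero    zero                = suc zero
  swapAdjacent zero    (suc zero)      = zero
  swapAdjacent zero    (suc (suc x))   = suc (suc x)
  swapAdjacent (suc p) zero                = zero
  swapAdjacent (suc p) (suc x)             = suc (swapAdjacent p x)

  swapAdjacent-inject₁ : ∀ {n} (p : Fin n) → swapAdjacent p (Fin.inject₁ p) ≡ suc p
  swapAdjacent-inject₁ zero    = ≡.refl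
  swapAdjacent-inject₁ (suc p) = ≡.cong Fin.suc (swapAdjacent-inject₁ p)

  swapAdjacent-suc : ∀ {n} (p : Fin n) → swapAdjacent p (suc p) ≡ Fin.inject₁ p
  swapAdjacent-suc zero    = ≡.refl
  swapAdjacent-suc (suc p) = ≡.cong Fin.suc (swapAdjacent-suc p)

  swapAdjacent-fixes : ∀ {n} (p : Fin n) i → i ≢ Fin.inject₁ p → i ≢ suc p → swapAdjacent p i ≡ i
  swapAdjacent-fixes zero    zero                i≢p _    = contradiction ≡.refl i≢p
  swapAdjacent-fixes zero    (suc zero)      _   i≢p+1 = contradiction ≡.refl i≢p+1
  swapAdjacent-fixes zero    (suc (suc i))   _   _    = ≡.refl
  swapAdjacent-fixes (suc p) zero                _   _    = ≡.refl
  swapAdjacent-fixes (suc p) (suc i)             i≢p i≢p+1 =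
    ≡.cong Fin.suc (swapAdjacent-fixes p i (i≢p ∘ ≡.cong Fin.suc) (i≢p+1 ∘ ≡.cong Fin.suc))

  swapAdjacent-punchIn-inject₁ : ∀ {n} (p : Fin n) a →
                                 swapAdjacent p (Fin.punchIn (Fin.inject₁ p) a) ≡ Fin.punchIn (suc p) a
  swapAdjacent-punchIn-inject₁ zero    zero    = ≡.refl
  swapAdjacent-punchIn-inject₁ zero    (suc a) = ≡.refl
  swapAdjacent-punchIn-inject₁ (suc p) zero    = ≡.refl
  swapAdjacent-punchIn-inject₁ (suc p) (suc a) = ≡.cong Fin.suc (swapAdjacent-punchIn-inject₁ p a)

  swapAdjacent-punchIn-suc : ∀ {n} (p : Fin n) a →
                             swapAdjacent p (Fin.punchIn (suc p) a) ≡ Fin.punchIn (Fin.inject₁ p) a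
  swapAdjacent-punchIn-suc zero    zero    = ≡.refl
  swapAdjacent-punchIn-suc zero    (suc a) = ≡.refl
  swapAdjacent-punchIn-suc (suc p) zero    = ≡.refl
  swapAdjacent-punchIn-suc (suc p) (suc a) = ≡.cong Fin.suc (swapAdjacent-punchIn-suc p a)

  swapAdjacent-punchIn : ∀ {m} (p : Fin (suc m)) i → i ≢ Fin.inject₁ p → i ≢ suc p →
                         Σ (Fin m) λ q → ∀ a → swapAdjacent p (Fin.punchIn i a) ≡ Fin.punchIn i (swapAdjacent q a)
  swapAdjacent-punchIn zero zero i≢p _ = contradiction ≡.refl i≢p
  swapAdjacent-punchIn zero (suc zero) _ i≢p+1 = contradiction ≡.refl i≢p+1
  swapAdjacent-punchIn {suc m} zero (suc (suc i)) _ _ = zero , commutes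
    where commutes : ∀ a → _
          commutes zero                = ≡.refl
          commutes (suc zero)      = ≡.refl
          commutes (suc (suc a))   = ≡.refl
  swapAdjacent-punchIn (suc p) zero _ _ = p , λ a → ≡.refl
  swapAdjacent-punchIn {suc m} (suc p) (suc i) i≢p i≢p+1
    with swapAdjacent-punchIn p i (i≢p ∘ ≡.cong Fin.suc) (i≢p+1 ∘ ≡.cong Fin.suc)
  ... | q , commutes = suc q , commutes′
    where commutes′ : ∀ a → _
          commutes′ zero    = ≡.refl
          commutes′ (suc a) = ≡.cong Fin.suc (commutes a)

  adjacent-punchIn : ∀ {m} (p : Fin (suc m)) i → i ≢ Fin.inject₁ p → i ≢ suc p →
                     Σ (Fin m) λ q → (Fin.punchIn i (Fin.inject₁ q) ≡ Fin.inject₁ p) × (Fin.punchIn i (suc q) ≡ suc p)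
  adjacent-punchIn zero zero i≢p _ = contradiction ≡.refl i≢p
  adjacent-punchIn zero (suc zero) _ i≢p+1 = contradiction ≡.refl i≢p+1
  adjacent-punchIn {suc m} zero (suc (suc i)) _ _ = zero , ≡.refl , ≡.refl
  adjacent-punchIn (suc p) zero _ _ = p , ≡.refl , ≡.refl
  adjacent-punchIn {suc m} (suc p) (suc i) i≢p i≢p+1
    with adjacent-punchIn p i (i≢p ∘ ≡.cong Fin.suc) (i≢p+1 ∘ ≡.cong Fin.suc)
  ... | q , e₁ , e₂ = suc q , ≡.cong Fin.suc e₁ , ≡.cong Fin.suc e₂

  punchIn-adjacent : ∀ {n} (p : Fin n) a →
                     Fin.punchIn (Fin.inject₁ p) a ≡ Fin.punchIn (suc p) a
                     ⊎ (Fin.punchIn (Fin.inject₁ p) a ≡ suc p × Fin.punchIn (suc p) a ≡ Fin.inject₁ p)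
  punchIn-adjacent zero    zero    = inj₂ (≡.refl , ≡.refl)
  punchIn-adjacent zero    (suc a) = inj₁ ≡.refl
  punchIn-adjacent (suc p) zero    = inj₁ ≡.refl
  punchIn-adjacent (suc p) (suc a) with punchIn-adjacent p a
  ... | inj₁ e         = inj₁ (≡.cong Fin.suc e)
  ... | inj₂ (e₁ , e₂) = inj₂ (≡.cong Fin.suc e₁ , ≡.cong Fin.suc e₂)

  punchIn-fromℕ : ∀ {n} (a : Fin n) → Fin.punchIn (Fin.fromℕ n) a ≡ Fin.inject₁ a
  punchIn-fromℕ zero    = ≡.refl
  punchIn-fromℕ (suc a) = ≡.cong Fin.suc (punchIn-fromℕ a)

  inject₁-fromℕ-elim : ∀ {p n} (P : Fin (suc n) → Set p) → (∀ a → P (Fin.inject₁ a)) → P (Fin.fromℕ n) → ∀ a → P a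
  inject₁-fromℕ-elim {n = zero}  P _     P-last zero    = P-last
  inject₁-fromℕ-elim {n = suc n} P P-inj _      zero    = P-inj zero
  inject₁-fromℕ-elim {n = suc n} P P-inj P-last (suc a) =
    inject₁-fromℕ-elim (P ∘ Fin.suc) (P-inj ∘ Fin.suc) P-last a

  -- The determinant is multilinear and alternating in the rows

  det-cong : ∀ {n} {A B : Matrix n} → (∀ a b → A a b ≈ B a b) → det A ≈ det B
  det-cong {zero}  _   = refl
  det-cong {suc n} A≈B =
    altSum-cong (λ i → *-cong (A≈B i zero) (det-cong (λ a b → A≈B (Fin.punchIn i a) (suc b))))

  det-cong-rows : ∀ {n} {A B : Matrix n} → (∀ a → A a ≡ B a) → det A ≈ det B
  det-cong-rows A≡B = det-cong (λ a b → reflexive (≡.cong-app (A≡B a) b))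

  firstColumnMinor : ∀ {n} → Matrix (suc n) → Fin (suc n) → Matrix n
  firstColumnMinor A i a b = A (Fin.punchIn i a) (suc b)

  det-linearInRow : ∀ {n} (A B C : Matrix n) p x y →
                    (∀ q → q ≢ p → ∀ b → A q b ≈ B q b) → (∀ q → q ≢ p → ∀ b → A q b ≈ C q b) →
                    (∀ b → A p b ≈ x * B p b + y * C p b) → det A ≈ x * det B + y * det C
  det-linearInRow {suc n} A B C p x y A≈B A≈C Aₚ≈ = altSum-linear x y _ _ _ term
    where
    term : ∀ i → A i zero * det (firstColumnMinor A i) ≈
                 x * (B i zero * det (firstColumnMinor B i)) + y * (C i zero * det (firstColumnMinor C i))
    term i with i Fin.≟ p
    ... | yes ≡.refl = begin
      A i zero * det (firstColumnMinor A i)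
        ≈⟨ *-congʳ (Aₚ≈ zero) ⟩
      (x * B i zero + y * C i zero) * det (firstColumnMinor A i)
        ≈⟨ solve 5 (λ x y b c d → (x :* b :+ y :* c) :* d := x :* (b :* d) :+ y :* (c :* d))
                 refl x y (B i zero) (C i zero) (det (firstColumnMinor A i)) ⟩
      x * (B i zero * det (firstColumnMinor A i)) + y * (C i zero * det (firstColumnMinor A i))
        ≈⟨ +-cong (*-congˡ (*-congˡ (offRow A≈B))) (*-congˡ (*-congˡ (offRow A≈C))) ⟩
      x * (B i zero * det (firstColumnMinor B i)) + y * (C i zero * det (firstColumnMinor C i)) ∎
      where
      offRow : ∀ {X} → (∀ q → q ≢ i → ∀ b → A q b ≈ X q b) → det (firstColumnMinor A i) ≈ det (firstColumnMinor X i)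
      offRow A≈X = det-cong (λ a b → A≈X (Fin.punchIn i a) (Fin.punchInᵢ≢i i a) (suc b))
    ... | no i≢p = begin
      A i zero * det (firstColumnMinor A i)
        ≈⟨ *-congˡ (det-linearInRow (firstColumnMinor A i) (firstColumnMinor B i) (firstColumnMinor C i) p′ x y
                      (onMinor A≈B) (onMinor A≈C) Aₚ′≈) ⟩
      A i zero * (x * det (firstColumnMinor B i) + y * det (firstColumnMinor C i))
        ≈⟨ solve 5 (λ a x y u v → a :* (x :* u :+ y :* v) := x :* (a :* u) :+ y :* (a :* v))
                 refl (A i zero) x y (det (firstColumnMinor B i)) (det (firstColumnMinor C i)) ⟩
      x * (A i zero * det (firstColumnMinor B i)) + y * (A i zero * det (firstColumnMinor C i))
        ≈⟨ +-cong (*-congˡ (*-congʳ (A≈B i i≢p zero))) (*-congˡ (*-congʳ (A≈C i i≢p zero))) ⟩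
      x * (B i zero * det (firstColumnMinor B i)) + y * (C i zero * det (firstColumnMinor C i)) ∎
      where
      p′ = Fin.punchOut i≢p
      i↑p′≡p : Fin.punchIn i p′ ≡ p
      i↑p′≡p = Fin.punchIn-punchOut i≢p
      onMinor : ∀ {X} → (∀ q → q ≢ p → ∀ b → A q b ≈ X q b) →
                ∀ q → q ≢ p′ → ∀ b → firstColumnMinor A i q b ≈ firstColumnMinor X i q b
      onMinor A≈X q q≢p′ b =
        A≈X (Fin.punchIn i q) (λ e → q≢p′ (Fin.punchIn-injective i q p′ (≡.trans e (≡.sym i↑p′≡p)))) (suc b)
      Aₚ′≈ : ∀ b → firstColumnMinor A i p′ b ≈ x * firstColumnMinor B i p′ b + y * firstColumnMinor C i p′ b
      Aₚ′≈ b = ≡.subst (λ q → A q (suc b) ≈ x * B q (suc b) + y * C q (suc b))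
                       (≡.sym i↑p′≡p) (Aₚ≈ (suc b))

  det-zeroRow : ∀ {n} (A : Matrix n) p → (∀ b → A p b ≈ 0#) → det A ≈ 0#
  det-zeroRow A p Aₚ≈0 =
    trans (det-linearInRow A A A p 0# 0# (λ _ _ _ → refl) (λ _ _ _ → refl) (λ b → trans (Aₚ≈0 b) (zero≈ (A p b))))
          (sym (zero≈ (det A)))
    where zero≈ : ∀ a → 0# ≈ 0# * a + 0# * a
          zero≈ = solve 1 (λ a → con (+ 0) := con (+ 0) :* a :+ con (+ 0) :* a) refl

  altSum-swapAdjacent : ∀ {n} (p : Fin n) (t t′ : Fin (suc n) → Carrier) →
                        (∀ i → i ≢ Fin.inject₁ p → i ≢ suc p → t′ i ≈ - t i) →
                        t′ (Fin.inject₁ p) ≈ t (suc p) → t′ (suc p) ≈ t (Fin.inject₁ p) →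
                        altSum t′ ≈ - altSum t
  altSum-swapAdjacent {suc n} zero t t′ t′≈-t t′ₚ≈ t′ₚ₊₁≈ = begin
    t′ zero - (t′ (suc zero) - altSum (t′ ∘ Fin.suc ∘ Fin.suc))
      ≈⟨ +-cong t′ₚ≈ (-‿cong (+-cong t′ₚ₊₁≈ (-‿cong (altSum-neg _ (t ∘ Fin.suc ∘ Fin.suc)
                                                        (λ i → t′≈-t (suc (suc i)) (λ ()) (λ ())))))) ⟩
    t (suc zero) - (t zero - - altSum (t ∘ Fin.suc ∘ Fin.suc))
      ≈⟨ solve 3 (λ a b s → b :- (a :- :- s) := :- (a :- (b :- s))) refl (t zero) (t (suc zero)) _ ⟩
    - (t zero - (t (suc zero) - altSum (t ∘ Fin.suc ∘ Fin.suc))) ∎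
  altSum-swapAdjacent (suc p) t t′ t′≈-t t′ₚ≈ t′ₚ₊₁≈ = begin
    t′ zero - altSum (t′ ∘ Fin.suc)
      ≈⟨ +-cong (t′≈-t zero (λ ()) (λ ()))
                (-‿cong (altSum-swapAdjacent p (t ∘ Fin.suc) (t′ ∘ Fin.suc)
                          (λ i i≢p i≢p+1 → t′≈-t (suc i) (i≢p ∘ Fin.suc-injective) (i≢p+1 ∘ Fin.suc-injective))
                          t′ₚ≈ t′ₚ₊₁≈)) ⟩
    - t zero - - altSum (t ∘ Fin.suc)
      ≈⟨ solve 2 (λ a s → :- a :- :- s := :- (a :- s)) refl (t zero) _ ⟩
    - (t zero - altSum (t ∘ Fin.suc)) ∎

  altSum-adjacentEqual : ∀ {n} (p : Fin n) (t : Fin (suc n) → Carrier) →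
                         (∀ i → i ≢ Fin.inject₁ p → i ≢ suc p → t i ≈ 0#) →
                         t (Fin.inject₁ p) ≈ t (suc p) → altSum t ≈ 0#
  altSum-adjacentEqual {suc n} zero t t≈0 tₚ≈tₚ₊₁ = begin
    t zero - (t (suc zero) - altSum (t ∘ Fin.suc ∘ Fin.suc))
      ≈⟨ +-cong tₚ≈tₚ₊₁ (-‿cong (+-congˡ (-‿cong (altSum-zero (t ∘ Fin.suc ∘ Fin.suc)
                                                            (λ i → t≈0 (suc (suc i)) (λ ()) (λ ())))))) ⟩
    t (suc zero) - (t (suc zero) - 0#)
      ≈⟨ solve 1 (λ a → a :- (a :- con (+ 0)) := con (+ 0)) refl _ ⟩
    0# ∎
  altSum-adjacentEqual (suc p) t t≈0 tₚ≈tₚ₊₁ = begin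
    t zero - altSum (t ∘ Fin.suc)
      ≈⟨ +-cong (t≈0 zero (λ ()) (λ ()))
                (-‿cong (altSum-adjacentEqual p (t ∘ Fin.suc)
                          (λ i i≢p i≢p+1 → t≈0 (suc i) (i≢p ∘ Fin.suc-injective) (i≢p+1 ∘ Fin.suc-injective))
                          tₚ≈tₚ₊₁)) ⟩
    0# - 0#
      ≈⟨ -‿inverseʳ 0# ⟩
    0# ∎

  det-swapAdjacent : ∀ {n} (p : Fin n) (A : Matrix (suc n)) → det (A ∘ swapAdjacent p) ≈ - det A
  det-swapAdjacent {suc m} p A = altSum-swapAdjacent p t t′ t′≈-t t′ₚ≈ t′ₚ₊₁≈
    where
    t t′ : Fin (suc (suc m)) → Carrier
    t  i = A i zero * det (firstColumnMinor A i)
    t′ i = A (swapAdjacent p i) zero * det (firstColumnMinor (A ∘ swapAdjacent p) i)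
    t′≈-t : ∀ i → i ≢ Fin.inject₁ p → i ≢ suc p → t′ i ≈ - t i
    t′≈-t i i≢p i≢p+1 with swapAdjacent-punchIn p i i≢p i≢p+1
    ... | q , commutes = begin
      A (swapAdjacent p i) zero * det (firstColumnMinor (A ∘ swapAdjacent p) i)
        ≈⟨ *-cong (reflexive (≡.cong (λ x → A x zero) (swapAdjacent-fixes p i i≢p i≢p+1)))
                  (det-cong-rows (λ a → ≡.cong (λ x → A x ∘ Fin.suc) (commutes a))) ⟩
      A i zero * det (firstColumnMinor A i ∘ swapAdjacent q)
        ≈⟨ *-congˡ (det-swapAdjacent q (firstColumnMinor A i)) ⟩
      A i zero * - det (firstColumnMinor A i)
        ≈⟨ -‿distribʳ-* _ _ ⟨
      - t i ∎
    t′ₚ≈ : t′ (Fin.inject₁ p) ≈ t (suc p)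
    t′ₚ≈ = *-cong (reflexive (≡.cong (λ x → A x zero) (swapAdjacent-inject₁ p)))
                  (det-cong-rows (λ a → ≡.cong (λ x → A x ∘ Fin.suc) (swapAdjacent-punchIn-inject₁ p a)))
    t′ₚ₊₁≈ : t′ (suc p) ≈ t (Fin.inject₁ p)
    t′ₚ₊₁≈ = *-cong (reflexive (≡.cong (λ x → A x zero) (swapAdjacent-suc p)))
                    (det-cong-rows (λ a → ≡.cong (λ x → A x ∘ Fin.suc) (swapAdjacent-punchIn-suc p a)))

  det-equalAdjacentRows : ∀ {n} (p : Fin n) (A : Matrix (suc n)) →
                          (∀ b → A (Fin.inject₁ p) b ≈ A (suc p) b) → det A ≈ 0#
  det-equalAdjacentRows {suc m} p A Aₚ≈Aₚ₊₁ = altSum-adjacentEqual p t t≈0 tₚ≈tₚ₊₁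
    where
    t : Fin (suc (suc m)) → Carrier
    t i = A i zero * det (firstColumnMinor A i)
    t≈0 : ∀ i → i ≢ Fin.inject₁ p → i ≢ suc p → t i ≈ 0#
    t≈0 i i≢p i≢p+1 with adjacent-punchIn p i i≢p i≢p+1
    ... | q , e₁ , e₂ = trans (*-congˡ (det-equalAdjacentRows q (firstColumnMinor A i) minorRows)) (zeroʳ _)
      where
      minorRows : ∀ b → A (Fin.punchIn i (Fin.inject₁ q)) (suc b) ≈ A (Fin.punchIn i (suc q)) (suc b)
      minorRows b rewrite e₁ | e₂ = Aₚ≈Aₚ₊₁ (suc b)
    tₚ≈tₚ₊₁ : t (Fin.inject₁ p) ≈ t (suc p)
    tₚ≈tₚ₊₁ = *-cong (Aₚ≈Aₚ₊₁ zero) (det-cong minorsAgree)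
      where
      minorsAgree : ∀ a b → firstColumnMinor A (Fin.inject₁ p) a b ≈ firstColumnMinor A (suc p) a b
      minorsAgree a b with punchIn-adjacent p a
      ... | inj₁ e         = reflexive (≡.cong (λ y → A y (suc b)) e)
      ... | inj₂ (e₁ , e₂) rewrite e₁ | e₂ = sym (Aₚ≈Aₚ₊₁ (suc b))

  det-equalRowsAtDistance : ∀ {n} d (A : Matrix n) p q → Fin.toℕ q ≡ suc (d ℕ.+ Fin.toℕ p) →
                            (∀ b → A p b ≈ A q b) → det A ≈ 0#
  det-equalRowsAtDistance {suc n} d A p zero () _
  det-equalRowsAtDistance {suc n} zero A p (suc q) q≡p+1 Aₚ≈A_q =
    det-equalAdjacentRows q A (≡.subst (λ x → ∀ b → A x b ≈ A (suc q) b) p≡q Aₚ≈A_q)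
    where
    p≡q : p ≡ Fin.inject₁ q
    p≡q = Fin.toℕ-injective (≡.trans (≡.sym (ℕ.suc-injective q≡p+1)) (≡.sym (Fin.toℕ-inject₁ q)))
  det-equalRowsAtDistance {suc n} (suc d) A p (suc q) q≡p+d+2 Aₚ≈A_q = begin
    det A                                ≈⟨ -‿involutive (det A) ⟨
    - - det A                            ≈⟨ -‿cong (det-swapAdjacent q A) ⟨
    - det (A ∘ swapAdjacent q)           ≈⟨ -‿cong (det-equalRowsAtDistance d (A ∘ swapAdjacent q) p (Fin.inject₁ q)
                                                      q′≡p+d+1 swapped) ⟩
    - 0#                                 ≈⟨ -0#≈0# ⟩
    0#                                   ∎
    where
    q≡p+d+1 : Fin.toℕ q ≡ suc (d ℕ.+ Fin.toℕ p)
    q≡p+d+1 = ℕ.suc-injective q≡p+d+2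
    q′≡p+d+1 : Fin.toℕ (Fin.inject₁ q) ≡ suc (d ℕ.+ Fin.toℕ p)
    q′≡p+d+1 = ≡.trans (Fin.toℕ-inject₁ q) q≡p+d+1
    p≢q : p ≢ Fin.inject₁ q
    p≢q p≡q = ℕ.m≢1+n+m (Fin.toℕ p) (≡.trans (≡.cong Fin.toℕ p≡q) q′≡p+d+1)
    p≢q+1 : p ≢ suc q
    p≢q+1 p≡q+1 = ℕ.m≢1+n+m (Fin.toℕ p) {suc d} (≡.trans (≡.cong Fin.toℕ p≡q+1) q≡p+d+2)
    swapped : ∀ b → A (swapAdjacent q p) b ≈ A (swapAdjacent q (Fin.inject₁ q)) b
    swapped b rewrite swapAdjacent-fixes q p p≢q p≢q+1 | swapAdjacent-inject₁ q = Aₚ≈A_q b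

  det-equalRows-< : ∀ {n} (A : Matrix n) p q → Fin.toℕ p ℕ.< Fin.toℕ q → (∀ b → A p b ≈ A q b) → det A ≈ 0#
  det-equalRows-< A p q p<q = det-equalRowsAtDistance _ A p q (≡.trans (≡.sym (ℕ.m∸n+n≡m p<q)) (ℕ.+-suc _ _))

  det-equalRows : ∀ {n} (A : Matrix n) p q → p ≢ q → (∀ b → A p b ≈ A q b) → det A ≈ 0#
  det-equalRows A p q p≢q Aₚ≈A_q with ℕ.<-cmp (Fin.toℕ p) (Fin.toℕ q)
  ... | tri< p<q _ _ = det-equalRows-< A p q p<q Aₚ≈A_q
  ... | tri≈ _ p≡q _ = contradiction (Fin.toℕ-injective p≡q) p≢q
  ... | tri> _ _ q<p = det-equalRows-< A q p q<p (λ b → sym (Aₚ≈A_q b))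

  _[_]≔_ : ∀ {n} → Matrix n → Fin n → (Fin n → Carrier) → Matrix n
  A [ p ]≔ v = updateAt A p (λ _ → v)

  det-expandRow : ∀ {n m} (A : Matrix n) p (cs : Fin m → Carrier) (V : Fin m → Fin n → Carrier) →
                  (∀ b → A p b ≈ sum (λ k → cs k * V k b)) → det A ≈ sum (λ k → cs k * det (A [ p ]≔ V k))
  det-expandRow {m = zero}  A p cs V Aₚ≈ = det-zeroRow A p Aₚ≈
  det-expandRow {m = suc m} A p cs V Aₚ≈ = begin
    det A
      ≈⟨ det-linearInRow A B C p (cs zero) 1# (agreeOff (V zero)) (agreeOff rest) splitRow ⟩
    cs zero * det B + 1# * det C
      ≈⟨ +-congˡ (*-identityˡ (det C)) ⟩
    cs zero * det B + det C
      ≈⟨ +-congˡ (det-expandRow C p (cs ∘ Fin.suc) (V ∘ Fin.suc) (λ b → reflexive (≡.cong-app (updateAt-updates p A) b))) ⟩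
    cs zero * det B + sum (λ k → cs (suc k) * det (C [ p ]≔ V (suc k)))
      ≈⟨ +-congˡ (sum-cong-≋ (λ k → *-congˡ (det-cong-rows (updateAt-updateAt p {λ _ → V (suc k)} {λ _ → rest} A)))) ⟩
    cs zero * det B + sum (λ k → cs (suc k) * det (A [ p ]≔ V (suc k))) ∎
    where
    rest : Fin _ → Carrier
    rest b = sum (λ k → cs (suc k) * V (suc k) b)
    B = A [ p ]≔ V zero
    C = A [ p ]≔ rest
    agreeOff : ∀ v q → q ≢ p → ∀ b → A q b ≈ (A [ p ]≔ v) q b
    agreeOff v q q≢p b = reflexive (≡.sym (≡.cong-app (updateAt-minimal q p A q≢p) b))
    splitRow : ∀ b → A p b ≈ cs zero * B p b + 1# * C p b
    splitRow b rewrite updateAt-updates p {λ _ → V zero} A | updateAt-updates p {λ _ → rest} A =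
      trans (Aₚ≈ b) (+-congˡ (sym (*-identityˡ (rest b))))

  det≉0⇒rowsIndependent : ∀ {n} (B : Matrix n) → ¬ det B ≈ 0# → (w : Fin n → Carrier) →
                          (∀ b → sum (λ a → w a * B a b) ≈ 0#) → ∀ p → w p ≈ 0#
  det≉0⇒rowsIndependent B det≉0 w w·B≈0 p = x≉0∧x*y≈0⇒y≈0 det≉0 (trans (*-comm (det B) (w p)) wₚdet≈0)
    where
    A = B [ p ]≔ (λ b → sum (λ a → w a * B a b))
    Aₚ≡ : A p ≡ (λ b → sum (λ a → w a * B a b))
    Aₚ≡ = updateAt-updates p B
    Aₖ≡ : ∀ k → k ≢ p → A k ≡ B k
    Aₖ≡ k k≢p = updateAt-minimal k p B k≢p
    otherTerms≈0 : ∀ k → k ≢ p → w k * det (A [ p ]≔ B k) ≈ 0#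
    otherTerms≈0 k k≢p = trans (*-congˡ (det-equalRows (A [ p ]≔ B k) p k (k≢p ∘ ≡.sym) rowsₚₖ)) (zeroʳ (w k))
      where
      rowsₚₖ : ∀ b → (A [ p ]≔ B k) p b ≈ (A [ p ]≔ B k) k b
      rowsₚₖ b rewrite updateAt-updates p {λ _ → B k} A | updateAt-minimal k p {λ _ → B k} A k≢p | Aₖ≡ k k≢p = refl
    wₚdet≈0 : w p * det B ≈ 0#
    wₚdet≈0 = begin
      w p * det B                              ≈⟨ *-congˡ (det-cong-rows (updateAt-id-local p {λ _ → B p} B ≡.refl)) ⟨
      w p * det (B [ p ]≔ B p)                 ≈⟨ *-congˡ (det-cong-rows (updateAt-updateAt p {λ _ → B p} {λ _ → _} B)) ⟨
      w p * det (A [ p ]≔ B p)                 ≈⟨ sum-single (λ k → w k * det (A [ p ]≔ B k)) p otherTerms≈0 ⟨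
      sum (λ k → w k * det (A [ p ]≔ B k))     ≈⟨ det-expandRow A p w B (λ b → reflexive (≡.cong-app Aₚ≡ b)) ⟨
      det A                                    ≈⟨ det-zeroRow A p (λ b → trans (reflexive (≡.cong-app Aₚ≡ b)) (w·B≈0 b)) ⟩
      0#                                       ∎

  -- Rows from d on are among the m vectors U, rows below d are combinations of them; expanding those rows
  -- one at a time leaves matrices whose n rows are all among the m < n vectors, so two of them coincide.
  det-rowsInSpanFrom : ∀ {n m} → m ℕ.< n → (U : Fin m → Fin n → Carrier) (cf : Fin n → Fin m → Carrier) →
                       ∀ d → d ℕ.≤ n → (A : Matrix n) (f : Fin n → Fin m) →
                       (∀ a → d ℕ.≤ Fin.toℕ a → A a ≡ U (f a)) →
                       (∀ a → Fin.toℕ a ℕ.< d → ∀ b → A a b ≈ sum (λ k → cf a k * U k b)) → det A ≈ 0#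
  det-rowsInSpanFrom m<n U cf zero _ A f Aₐ≡U _ with Fin.pigeonhole m<n f
  ... | i , j , i<j , fᵢ≡fⱼ = det-equalRows A i j (λ i≡j → ℕ.<-irrefl (≡.cong Fin.toℕ i≡j) i<j) rowsᵢⱼ
    where
    rowsᵢⱼ : ∀ b → A i b ≈ A j b
    rowsᵢⱼ b rewrite Aₐ≡U i ℕ.z≤n | Aₐ≡U j ℕ.z≤n | fᵢ≡fⱼ = refl
  det-rowsInSpanFrom m<n U cf (suc d) d<n A f Aₐ≡U Aₐ∈span = begin
    det A
      ≈⟨ det-expandRow A p (cf p) U (Aₐ∈span p (≡.subst (ℕ._< suc d) (≡.sym p≡d) (ℕ.n<1+n d))) ⟩
    sum (λ k → cf p k * det (A [ p ]≔ U k))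
      ≈⟨ sum-zero _ (λ k → trans (*-congˡ (expanded≈0 k)) (zeroʳ (cf p k))) ⟩
    0# ∎
    where
    p = Fin.fromℕ< d<n
    p≡d : Fin.toℕ p ≡ d
    p≡d = Fin.toℕ-fromℕ< d<n
    expanded≈0 : ∀ k → det (A [ p ]≔ U k) ≈ 0#
    expanded≈0 k = det-rowsInSpanFrom m<n U cf d (ℕ.<⇒≤ d<n) (A [ p ]≔ U k) (updateAt f p (λ _ → k)) tail head
      where
      tail : ∀ a → d ℕ.≤ Fin.toℕ a → (A [ p ]≔ U k) a ≡ U (updateAt f p (λ _ → k) a)
      tail a d≤a with a Fin.≟ p
      ... | yes ≡.refl = ≡.trans (updateAt-updates a A) (≡.cong U (≡.sym (updateAt-updates a f)))
      ... | no a≢p     = ≡.trans (updateAt-minimal a p A a≢p)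
                                 (≡.trans (Aₐ≡U a d<a) (≡.cong U (≡.sym (updateAt-minimal a p f a≢p))))
        where
        d<a : suc d ℕ.≤ Fin.toℕ a
        d<a = ℕ.≤∧≢⇒< d≤a (λ d≡a → a≢p (Fin.toℕ-injective (≡.trans (≡.sym d≡a) (≡.sym p≡d))))
      head : ∀ a → Fin.toℕ a ℕ.< d → ∀ b → (A [ p ]≔ U k) a b ≈ sum (λ k′ → cf a k′ * U k′ b)
      head a a<d b = trans (reflexive (≡.cong-app (updateAt-minimal a p A a≢p) b)) (Aₐ∈span a (ℕ.m<n⇒m<1+n a<d) b)
        where
        a≢p : a ≢ p
        a≢p a≡p = ℕ.<-irrefl (≡.trans (≡.cong Fin.toℕ a≡p) p≡d) a<d

  det-rowsInSpan : ∀ {n m} → m ℕ.< n → (A : Matrix n) (U : Fin m → Fin n → Carrier) (cf : Fin n → Fin m → Carrier) →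
                   (∀ a b → A a b ≈ sum (λ k → cf a k * U k b)) → det A ≈ 0#
  det-rowsInSpan {suc n} {zero}  _   A U cf A≈ = det-zeroRow A zero (A≈ zero)
  det-rowsInSpan {n}     {suc m} m<n A U cf A≈ =
    det-rowsInSpanFrom m<n U cf n ℕ.≤-refl A (λ _ → zero)
                       (λ a n≤a → contradiction n≤a (ℕ.<⇒≱ (Fin.toℕ<n a))) (λ a _ → A≈ a)

  -- A matrix with two equal columns is singular

  -- A summand indexed by two distinct rows x, y of an (n+2)-row matrix and the remaining rows ρ, in order.
  PairTerms : ℕ → Set c
  PairTerms n = Fin (suc (suc n)) → Fin (suc (suc n)) → (Fin n → Fin (suc (suc n))) → Carrier

  pairSum : ∀ {n} → PairTerms n → Carrier
  pairSum H = altSum (λ a → altSum (λ l → H a (Fin.punchIn a l) (Fin.punchIn a ∘ Fin.punchIn l)))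

  pairsAvoidingZero : ∀ {n} → PairTerms n → Fin (suc n) → Carrier
  pairsAvoidingZero H a =
    altSum (λ l → H (suc a) (suc (Fin.punchIn a l)) (Fin.punchIn (suc a) ∘ Fin.punchIn (suc l)))

  Extensional : ∀ {n} → PairTerms n → Set ℓ
  Extensional H = ∀ x y ρ ρ′ → (∀ z → ρ z ≡ ρ′ z) → H x y ρ ≈ H x y ρ′

  Symmetric : ∀ {n} → PairTerms n → Set ℓ
  Symmetric H = ∀ x y ρ → H x y ρ ≈ H y x ρ

  -- The pairs {0, y} cancel in pairSum by symmetry of H.
  pairSum-symmetric-peel : ∀ {n} (H : PairTerms n) → Symmetric H → altSum (pairsAvoidingZero H) ≈ 0# →
                           pairSum H ≈ 0#
  pairSum-symmetric-peel {n} H sym-H rest≈0 = begin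
    X - altSum (λ a → Y a - Z a)
      ≈⟨ +-congˡ (-‿cong (altSum-linear 1# (- 1#) _ Y Z (λ a → split (Y a) (Z a)))) ⟩
    X - (1# * altSum Y + - 1# * altSum Z)
      ≈⟨ +-congˡ (-‿cong (+-cong (*-congˡ altSum-Y≈X) (*-congˡ rest≈0))) ⟩
    X - (1# * X + - 1# * 0#)
      ≈⟨ solve 1 (λ x → x :- (con (+ 1) :* x :+ con (Int.- + 1) :* con (+ 0)) := con (+ 0)) refl X ⟩
    0# ∎
    where
    X = altSum (λ l → H zero (suc l) (Fin.suc ∘ Fin.punchIn l))
    Y Z : Fin (suc n) → Carrier
    Y a = H (suc a) zero (Fin.suc ∘ Fin.punchIn a)
    Z = pairsAvoidingZero H
    split : ∀ y z → y - z ≈ 1# * y + - 1# * z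
    split = solve 2 (λ y z → y :- z := con (+ 1) :* y :+ con (Int.- + 1) :* z) refl
    altSum-Y≈X : altSum Y ≈ X
    altSum-Y≈X = altSum-cong (λ a → sym-H (suc a) zero (Fin.suc ∘ Fin.punchIn a))

  -- Every unordered pair of rows {x, y} occurs twice in pairSum, with opposite signs.
  pairSum-symmetric : ∀ {n} (H : PairTerms n) → Extensional H → Symmetric H → pairSum H ≈ 0#
  pairSum-symmetric {zero}  H ext sym-H =
    pairSum-symmetric-peel H sym-H (altSum-zero (pairsAvoidingZero H) (λ _ → refl))
  pairSum-symmetric {suc m} H ext sym-H = pairSum-symmetric-peel H sym-H
    (trans (altSum-cong (λ a → altSum-cong (λ l → ext (suc a) (suc (Fin.punchIn a l)) _ _ (liftRemaining a l))))
           (pairSum-symmetric H₊ ext₊ sym-H₊))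
    where
    lift : (Fin m → Fin (suc (suc m))) → Fin (suc m) → Fin (suc (suc (suc m)))
    lift ρ zero    = zero
    lift ρ (suc z) = suc (ρ z)
    H₊ : PairTerms m
    H₊ x y ρ = H (suc x) (suc y) (lift ρ)
    ext₊ : Extensional H₊
    ext₊ x y ρ ρ′ ρ≡ρ′ = ext _ _ _ _ (λ { zero → ≡.refl ; (suc z) → ≡.cong Fin.suc (ρ≡ρ′ z) })
    sym-H₊ : Symmetric H₊
    sym-H₊ x y ρ = sym-H (suc x) (suc y) _
    liftRemaining : ∀ a l z → Fin.punchIn (suc a) (Fin.punchIn (suc l) z)
                              ≡ lift (Fin.punchIn a ∘ Fin.punchIn l) z
    liftRemaining a l zero    = ≡.refl
    liftRemaining a l (suc z) = ≡.refl

  pairSum-distrib-+ : ∀ {n} (H H′ : PairTerms n) → pairSum (λ x y ρ → H x y ρ + H′ x y ρ) ≈ pairSum H + pairSum H′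
  pairSum-distrib-+ H H′ =
    trans (altSum-cong (λ a → altSum-distrib-+ (terms H a) (terms H′ a)))
          (altSum-distrib-+ (λ a → altSum (terms H a)) (λ a → altSum (terms H′ a)))
    where
    terms : PairTerms _ → ∀ a l → Carrier
    terms G a l = G a (Fin.punchIn a l) (Fin.punchIn a ∘ Fin.punchIn l)

  -- Expanding also the minors along their first column turns the determinant into a pairSum; with k = 0 it
  -- is symmetric, otherwise adding the summands with x, y swapped (whose pairSum vanishes by induction on
  -- the size) makes it symmetric.
  det-duplicateColumn : ∀ {n} (R : Fin (suc n) → Fin n → Carrier) k → det (λ a → R a k ∷ R a) ≈ 0#
  det-duplicateColumn {suc n} R k = trans (altSum-cong (λ a → *-distribˡ-altSum (R a k) (expansion a))) (pairSum≈0 k)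
    where
    D : (Fin n → Fin (suc (suc n))) → Carrier
    D ρ = det (λ a b → R (ρ a) (suc b))
    expansion : Fin (suc (suc n)) → Fin (suc n) → Carrier
    expansion a l = R (Fin.punchIn a l) zero * D (Fin.punchIn a ∘ Fin.punchIn l)
    H : Fin (suc n) → PairTerms n
    H k x y ρ = R x k * (R y zero * D ρ)
    ext : ∀ k → Extensional (H k)
    ext k x y ρ ρ′ ρ≡ρ′ = *-congˡ (*-congˡ (det-cong-rows (λ a → ≡.cong (λ z → R z ∘ Fin.suc) (ρ≡ρ′ a))))
    pairSum≈0 : ∀ k → pairSum (H k) ≈ 0#
    pairSum≈0 zero = pairSum-symmetric (H zero) (ext zero)
      (λ x y ρ → solve 3 (λ a b d → a :* (b :* d) := b :* (a :* d)) refl (R x zero) (R y zero) (D ρ))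
    pairSum≈0 (suc k′) = begin
      pairSum Hₖ                                ≈⟨ +-identityʳ _ ⟨
      pairSum Hₖ + 0#                           ≈⟨ +-congˡ swapped≈0 ⟨
      pairSum Hₖ + pairSum H′                   ≈⟨ pairSum-distrib-+ Hₖ H′ ⟨
      pairSum (λ x y ρ → Hₖ x y ρ + H′ x y ρ)   ≈⟨ pairSum-symmetric _ (λ x y ρ ρ′ e → +-cong (extₖ x y ρ ρ′ e) (extₖ y x ρ ρ′ e))
                                                                       (λ x y ρ → +-comm _ _) ⟩
      0#                                        ∎
      where
      Hₖ = H (suc k′)
      extₖ = ext (suc k′)
      H′ : PairTerms n
      H′ x y ρ = Hₖ y x ρ
      swapped≈0 : pairSum H′ ≈ 0#
      swapped≈0 = altSum-zero _ λ a → begin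
        altSum (λ l → R (Fin.punchIn a l) (suc k′) * (R a zero * D (Fin.punchIn a ∘ Fin.punchIn l)))
          ≈⟨ altSum-cong (λ l → solve 3 (λ u v d → u :* (v :* d) := v :* (u :* d))
                               refl (R (Fin.punchIn a l) (suc k′)) (R a zero) (D (Fin.punchIn a ∘ Fin.punchIn l))) ⟩
        altSum (λ l → R a zero * (R (Fin.punchIn a l) (suc k′) * D (Fin.punchIn a ∘ Fin.punchIn l)))
          ≈⟨ *-distribˡ-altSum (R a zero) (λ l → R (Fin.punchIn a l) (suc k′) * D (Fin.punchIn a ∘ Fin.punchIn l)) ⟨
        R a zero * det (λ l → R (Fin.punchIn a l) (suc k′) ∷ (R (Fin.punchIn a l) ∘ Fin.suc))
          ≈⟨ *-congˡ (det-duplicateColumn (λ l b → R (Fin.punchIn a l) (suc b)) k′) ⟩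
        R a zero * 0#
          ≈⟨ zeroʳ _ ⟩
        0# ∎

  -- Cofactors of the first column

  cofactor : ∀ {n} → Matrix (suc n) → Fin (suc n) → Carrier
  cofactor A a = sign a * det (firstColumnMinor A a)

  sum-cofactor : ∀ {n} (A : Matrix (suc n)) (x : Fin (suc n) → Carrier) →
                 sum (λ a → cofactor A a * x a) ≈ det (λ a → x a ∷ (A a ∘ Fin.suc))
  sum-cofactor A x = begin
    sum (λ a → cofactor A a * x a)
      ≈⟨ sum-cong-≋ (λ a → solve 3 (λ s d y → (s :* d) :* y := s :* (y :* d))
                                   refl (sign a) (det (firstColumnMinor A a)) (x a)) ⟩
    sum (λ a → sign a * (x a * det (firstColumnMinor A a)))
      ≈⟨ altSum≈sum-sign (λ a → x a * det (firstColumnMinor A a)) ⟨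
    altSum (λ a → x a * det (firstColumnMinor A a)) ∎

  det≈0⇒cofactors-annihilate : ∀ {n} (A : Matrix (suc n)) → det A ≈ 0# → ∀ b → sum (λ a → cofactor A a * A a b) ≈ 0#
  det≈0⇒cofactors-annihilate A det≈0 zero =
    trans (sum-cofactor A (λ a → A a zero)) (trans (det-cong sameMatrix) det≈0)
    where
    sameMatrix : ∀ a b → (A a zero ∷ (A a ∘ Fin.suc)) b ≈ A a b
    sameMatrix a zero    = refl
    sameMatrix a (suc b) = refl
  det≈0⇒cofactors-annihilate A _ (suc k) =
    trans (sum-cofactor A (λ a → A a (suc k))) (det-duplicateColumn (λ a → A a ∘ Fin.suc) k)

  cofactor-zero : ∀ {n} (A : Matrix (suc n)) → cofactor A zero ≈ det (λ a b → A (suc a) (suc b))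
  cofactor-zero A = *-identityˡ _

  cofactor-last : ∀ {n} (A : Matrix (suc n)) →
                  cofactor A (Fin.fromℕ n) ≈ sign (Fin.fromℕ n) * det (λ a b → A (Fin.inject₁ a) (suc b))
  cofactor-last A = *-congˡ (det-cong-rows (λ a → ≡.cong (λ x → A x ∘ Fin.suc) (punchIn-fromℕ a)))

  annihilators-proportional : ∀ {n} (A : Fin (suc n) → Fin n → Carrier) → ¬ det (A ∘ Fin.inject₁) ≈ 0# →
                              (v g : Fin (suc n) → Carrier) →
                              (∀ b → sum (λ a → v a * A a b) ≈ 0#) → (∀ b → sum (λ a → g a * A a b) ≈ 0#) →
                              ∀ a → g (Fin.fromℕ n) * v a ≈ v (Fin.fromℕ n) * g a
  annihilators-proportional {n} A det≉0 v g v·A≈0 g·A≈0 =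
    inject₁-fromℕ-elim _ (λ a → x∙y⁻¹≈ε⇒x≈y _ _ (trans (+-congˡ (-‿distribˡ-* _ _)) (w≈0 a))) (*-comm _ _)
    where
    L = Fin.fromℕ n
    w : Fin (suc n) → Carrier
    w a = g L * v a + - v L * g a
    wL≈0 : w L ≈ 0#
    wL≈0 = solve 2 (λ x y → x :* y :+ :- y :* x := con (+ 0)) refl (g L) (v L)
    w·A≈0 : ∀ b → sum (λ a → w a * A a b) ≈ 0#
    w·A≈0 b = begin
      sum (λ a → w a * A a b)
        ≈⟨ sum-cong-≋ (λ a → distribʳ (A a b) (g L * v a) (- v L * g a)) ⟩
      sum (λ a → g L * v a * A a b + - v L * g a * A a b)
        ≈⟨ sum-cong-≋ (λ a → +-cong (*-assoc (g L) (v a) (A a b)) (*-assoc (- v L) (g a) (A a b))) ⟩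
      sum (λ a → g L * (v a * A a b) + - v L * (g a * A a b))
        ≈⟨ sum-linear (g L) (- v L) (λ a → v a * A a b) (λ a → g a * A a b) ⟩
      g L * sum (λ a → v a * A a b) + - v L * sum (λ a → g a * A a b)
        ≈⟨ +-cong (*-congˡ (v·A≈0 b)) (*-congˡ (g·A≈0 b)) ⟩
      g L * 0# + - v L * 0#
        ≈⟨ solve 2 (λ x y → x :* con (+ 0) :+ y :* con (+ 0) := con (+ 0)) refl (g L) (- v L) ⟩
      0# ∎
    wₙ·Aₙ≈0 : ∀ b → sum (λ a → w (Fin.inject₁ a) * A (Fin.inject₁ a) b) ≈ 0#
    wₙ·Aₙ≈0 b = begin
      sum (λ a → w (Fin.inject₁ a) * A (Fin.inject₁ a) b)          ≈⟨ +-identityʳ _ ⟨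
      sum (λ a → w (Fin.inject₁ a) * A (Fin.inject₁ a) b) + 0#     ≈⟨ +-congˡ (trans (*-congʳ wL≈0) (zeroˡ _)) ⟨
      sum (λ a → w (Fin.inject₁ a) * A (Fin.inject₁ a) b) + w L * A L b
                                                                    ≈⟨ sum-init-last (λ a → w a * A a b) ⟨
      sum (λ a → w a * A a b)                                      ≈⟨ w·A≈0 b ⟩
      0#                                                           ∎
    w≈0 : ∀ a → w (Fin.inject₁ a) ≈ 0#
    w≈0 = det≉0⇒rowsIndependent (A ∘ Fin.inject₁) det≉0 (w ∘ Fin.inject₁) wₙ·Aₙ≈0

  proportional-annihilates : ∀ {n} (v g : Fin (suc n) → Carrier) → ¬ g (Fin.fromℕ n) ≈ 0# →
                             (∀ a → g (Fin.fromℕ n) * v a ≈ v (Fin.fromℕ n) * g a) →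
                             (x : Fin (suc n) → Carrier) → sum (λ a → g a * x a) ≈ 0# → sum (λ a → v a * x a) ≈ 0#
  proportional-annihilates {n} v g gL≉0 v∝g x g·x≈0 = x≉0∧x*y≈0⇒y≈0 gL≉0 (begin
    g L * sum (λ a → v a * x a)       ≈⟨ *-distribˡ-sum (g L) (λ a → v a * x a) ⟩
    sum (λ a → g L * (v a * x a))     ≈⟨ sum-cong-≋ (λ a → trans (sym (*-assoc (g L) (v a) (x a)))
                                                               (trans (*-congʳ (v∝g a)) (*-assoc (v L) (g a) (x a)))) ⟩
    sum (λ a → v L * (g a * x a))     ≈⟨ *-distribˡ-sum (v L) (λ a → g a * x a) ⟨
    v L * sum (λ a → g a * x a)       ≈⟨ *-congˡ g·x≈0 ⟩
    v L * 0#                          ≈⟨ zeroʳ (v L) ⟩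
    0#                                ∎)
    where L = Fin.fromℕ n

  dependentRow-inSpan : ∀ {n} {C : Set} (v : Fin (suc n) → Carrier) p → ¬ v p ≈ 0# → (X : Fin (suc n) → C → Carrier) →
                        (∀ col → sum (λ a → v a * X a col) ≈ 0#) →
                        Σ (Fin n → Carrier) λ coeff → ∀ col → X p col ≈ sum (λ a → coeff a * X (Fin.punchIn p a) col)
  dependentRow-inSpan v p vₚ≉0 X v·X≈0 with inverse (v p) vₚ≉0
  ... | z , vₚz≈1 = (λ a → - (z * v (Fin.punchIn p a))) , solved
    where
    solved : ∀ col → X p col ≈ sum (λ a → - (z * v (Fin.punchIn p a)) * X (Fin.punchIn p a) col)
    solved col = begin
      X p col
        ≈⟨ *-identityˡ _ ⟨
      1# * X p col
        ≈⟨ *-congʳ vₚz≈1 ⟨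
      (v p * z) * X p col
        ≈⟨ solve 4 (λ u z x s → (u :* z) :* x := z :* (u :* x :+ s) :+ :- z :* s) refl (v p) z (X p col) rest ⟩
      z * (v p * X p col + rest) + - z * rest
        ≈⟨ +-congʳ (*-congˡ (trans (sym (sum-remove {i = p} (λ a → v a * X a col))) (v·X≈0 col))) ⟩
      z * 0# + - z * rest
        ≈⟨ trans (+-congʳ (zeroʳ z)) (+-identityˡ _) ⟩
      - z * rest
        ≈⟨ *-distribˡ-sum (- z) (λ a → v (p ↑ a) * X (p ↑ a) col) ⟩
      sum (λ a → - z * (v (p ↑ a) * X (p ↑ a) col))
        ≈⟨ sum-cong-≋ (λ a → trans (sym (*-assoc (- z) (v (p ↑ a)) _)) (*-congʳ (sym (-‿distribˡ-* z _)))) ⟩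
      sum (λ a → - (z * v (p ↑ a)) * X (p ↑ a) col) ∎
      where
      _↑_ = Fin.punchIn
      rest = sum (λ a → v (p ↑ a) * X (p ↑ a) col)

ℤ-induction : ∀ {p} (P : ℤ → Set p) → P (+ 0) → (∀ i → P i → P (i +ℤ + 1)) → (∀ i → P i → P (i -ℤ + 1)) →
              ∀ i → P i
ℤ-induction P P₀ up down (+ zero)     = P₀
ℤ-induction P P₀ up down (+ suc n)    =
  ≡.subst P (≡.cong +_ (ℕ.+-comm n 1)) (up (+ n) (ℤ-induction P P₀ up down (+ n)))
ℤ-induction P P₀ up down -[1+ zero ]  = down (+ 0) P₀
ℤ-induction P P₀ up down -[1+ suc n ] =
  ≡.subst P (≡.cong (λ k → -[1+ suc k ]) (ℕ.+-identityʳ n)) (down -[1+ n ] (ℤ-induction P P₀ up down -[1+ n ]))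

i+[1+n]≡[i+1]+n : ∀ i n → i +ℤ + suc n ≡ (i +ℤ + 1) +ℤ + n
i+[1+n]≡[i+1]+n i n = ≡.sym (Int.+-assoc i (+ 1) (+ n))

[i-1]+1≡i : ∀ i → (i -ℤ + 1) +ℤ + 1 ≡ i
[i-1]+1≡i = solve-∀

[i-1]+[1+n]≡i+n : ∀ i n → (i -ℤ + 1) +ℤ + suc n ≡ i +ℤ + n
[i-1]+[1+n]≡i+n i n = ≡.trans (i+[1+n]≡[i+1]+n (i -ℤ + 1) n) (≡.cong (_+ℤ + n) ([i-1]+1≡i i))

module ContiguousMinors {c ℓ} (K : Field c ℓ) (M : ZMatrix K) (r′ : ℕ)
  (vanish     : ∀ i j → Field._≈_ K (contiguousMinor K M (suc (suc r′)) i j) (Field.0# K))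
  (diagonal≉0 : ∀ i → ¬ Field._≈_ K (contiguousMinor K M (suc r′) i i) (Field.0# K)) where

  open Field K hiding (zero)
  open LinearAlgebra K
  open import Algebra.Properties.Semiring.Sum semiring using (sum; sum-cong-≋)
  open import Relation.Binary.Reasoning.Setoid setoid

  r : ℕ
  r = suc r′

  L : Fin (suc r)
  L = Fin.fromℕ r

  M-cong : ∀ {i i′ j j′} → i ≡ i′ → j ≡ j′ → M i j ≈ M i′ j′
  M-cong ≡.refl ≡.refl = refl

  window : ∀ n → ℤ → ℤ → Matrix n
  window n i j a b = M (interval K n i a) (interval K n j b)

  D : ℤ → ℤ → Carrier
  D = contiguousMinor K M r

  Nonvanishing : ℤ → ℤ → Set ℓ
  Nonvanishing i j = ¬ D i j ≈ 0#

  cofactors : ℤ → ℤ → Fin (suc r) → Carrier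
  cofactors i j = cofactor (window (suc r) i j)

  Annihilates : (Fin (suc r) → Carrier) → ℤ → ℤ → Set ℓ
  Annihilates v i col = sum (λ a → v a * M (interval K (suc r) i a) col) ≈ 0#

  AnnihilatesWindow : (Fin (suc r) → Carrier) → ℤ → ℤ → Set ℓ
  AnnihilatesWindow v i j = ∀ k → k ℕ.< r → Annihilates v i (j +ℤ + k)

  cofactors-annihilate : ∀ i j k → k ℕ.≤ r → Annihilates (cofactors i j) i (j +ℤ + k)
  cofactors-annihilate i j k k≤r =
    ≡.subst (λ t → Annihilates (cofactors i j) i (j +ℤ + t)) (Fin.toℕ-fromℕ< (ℕ.s≤s k≤r))
            (det≈0⇒cofactors-annihilate (window (suc r) i j) (vanish i j) (Fin.fromℕ< (ℕ.s≤s k≤r)))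

  cofactors-annihilateWindow : ∀ i j → AnnihilatesWindow (cofactors i j) i j
  cofactors-annihilateWindow i j k k<r = cofactors-annihilate i j k (ℕ.<⇒≤ k<r)

  cofactors-annihilateNextWindow : ∀ i j → AnnihilatesWindow (cofactors i (j -ℤ + 1)) i j
  cofactors-annihilateNextWindow i j k k<r = ≡.subst (Annihilates (cofactors i (j -ℤ + 1)) i) ([i-1]+[1+n]≡i+n j k)
                                                     (cofactors-annihilate i (j -ℤ + 1) (suc k) k<r)

  cofactors-zero : ∀ i j → cofactors i j zero ≈ D (i +ℤ + 1) (j +ℤ + 1)
  cofactors-zero i j = trans (cofactor-zero (window (suc r) i j)) (det-cong {B = window r (i +ℤ + 1) (j +ℤ + 1)}
    (λ a b → M-cong (i+[1+n]≡[i+1]+n i (Fin.toℕ a)) (i+[1+n]≡[i+1]+n j (Fin.toℕ b))))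

  cofactors-last : ∀ i j → cofactors i j L ≈ sign L * D i (j +ℤ + 1)
  cofactors-last i j = trans (cofactor-last (window (suc r) i j)) (*-congˡ (det-cong {B = window r i (j +ℤ + 1)}
    (λ a b → M-cong (≡.cong (i +ℤ_) (≡.cong +_ (Fin.toℕ-inject₁ a))) (i+[1+n]≡[i+1]+n j (Fin.toℕ b)))))

  window-proportional : ∀ i j → Nonvanishing i j → ∀ v g → AnnihilatesWindow v i j → AnnihilatesWindow g i j →
                        ∀ a → g L * v a ≈ v L * g a
  window-proportional i j D≉0 v g v-ann g-ann =
    annihilators-proportional A (D≉0 ∘ trans topBlock) v g (λ b → v-ann (Fin.toℕ b) (Fin.toℕ<n b))
                                                           (λ b → g-ann (Fin.toℕ b) (Fin.toℕ<n b))
    where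
    A : Fin (suc r) → Fin r → Carrier
    A a b = M (interval K (suc r) i a) (interval K r j b)
    topBlock : D i j ≈ det (A ∘ Fin.inject₁)
    topBlock = det-cong {B = A ∘ Fin.inject₁}
                        (λ a b → M-cong (≡.cong (i +ℤ_) (≡.cong +_ (≡.sym (Fin.toℕ-inject₁ a)))) ≡.refl)

  condensation : ∀ i j → Nonvanishing i j → D i j * D (i +ℤ + 1) (j +ℤ + 1) ≈ D i (j +ℤ + 1) * D (i +ℤ + 1) j
  condensation i j D≉0 = x≉0∧x*y≈x*z⇒y≈z (sign≉0 L) (begin
    sign L * (D i j * D (i +ℤ + 1) (j +ℤ + 1))   ≈⟨ *-assoc _ _ _ ⟨
    sign L * D i j * D (i +ℤ + 1) (j +ℤ + 1)     ≈⟨ *-cong g′-last (cofactors-zero i j) ⟨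
    g′ L * g zero                                 ≈⟨ window-proportional i j D≉0 g g′ (cofactors-annihilateWindow i j)
                                                                                     (cofactors-annihilateNextWindow i j) zero ⟩
    g L * g′ zero                                 ≈⟨ *-cong (cofactors-last i j) g′-zero ⟩
    sign L * D i (j +ℤ + 1) * D (i +ℤ + 1) j     ≈⟨ *-assoc _ _ _ ⟩
    sign L * (D i (j +ℤ + 1) * D (i +ℤ + 1) j)   ∎)
    where
    g  = cofactors i j
    g′ = cofactors i (j -ℤ + 1)
    g′-last : g′ L ≈ sign L * D i j
    g′-last = trans (cofactors-last i (j -ℤ + 1)) (*-congˡ (reflexive (≡.cong (D i) ([i-1]+1≡i j))))
    g′-zero : g′ zero ≈ D (i +ℤ + 1) j
    g′-zero = trans (cofactors-zero i (j -ℤ + 1)) (reflexive (≡.cong (D (i +ℤ + 1)) ([i-1]+1≡i j)))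

  condensation-≉0 : ∀ i j → Nonvanishing i j → Nonvanishing (i +ℤ + 1) (j +ℤ + 1) →
                    Nonvanishing i (j +ℤ + 1) × Nonvanishing (i +ℤ + 1) j
  condensation-≉0 i j D≉0 D₊≉0 = x*y≉0⇒x≉0 product≉0 , x*y≉0⇒y≉0 product≉0
    where
    product≉0 : ¬ D i (j +ℤ + 1) * D (i +ℤ + 1) j ≈ 0#
    product≉0 = x≉0∧y≉0⇒x*y≉0 D≉0 D₊≉0 ∘ trans (condensation i j D≉0)

  -- Induction on the offset j - i of a minor from the diagonal, in both directions.
  contiguousMinors≉0 : ∀ i j → Nonvanishing i j
  contiguousMinors≉0 i j = ≡.subst (Nonvanishing i) (i+[j-i]≡j i j) (offset≉0 (j -ℤ i) i)
    where
    OffsetNonvanishing : ℤ → Set ℓ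
    OffsetNonvanishing d = ∀ i → Nonvanishing i (i +ℤ d)
    i+[j-i]≡j : ∀ i j → i +ℤ (j -ℤ i) ≡ j
    i+[j-i]≡j = solve-∀
    [i+1]+d≡[i+d]+1 : ∀ i d → (i +ℤ + 1) +ℤ d ≡ (i +ℤ d) +ℤ + 1
    [i+1]+d≡[i+d]+1 = solve-∀
    [i-1]+d+1≡i+d : ∀ i d → ((i -ℤ + 1) +ℤ d) +ℤ + 1 ≡ i +ℤ d
    [i-1]+d+1≡i+d = solve-∀
    [i-1]+d≡i+[d-1] : ∀ i d → (i -ℤ + 1) +ℤ d ≡ i +ℤ (d -ℤ + 1)
    [i-1]+d≡i+[d-1] = solve-∀
    up : ∀ d → OffsetNonvanishing d → OffsetNonvanishing (d +ℤ + 1)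
    up d D≉0 i = ≡.subst (Nonvanishing i) (Int.+-assoc i d (+ 1)) (proj₁ (condensation-≉0 i (i +ℤ d) (D≉0 i)
      (≡.subst (Nonvanishing (i +ℤ + 1)) ([i+1]+d≡[i+d]+1 i d) (D≉0 (i +ℤ + 1)))))
    down : ∀ d → OffsetNonvanishing d → OffsetNonvanishing (d -ℤ + 1)
    down d D≉0 i = ≡.subst₂ Nonvanishing ([i-1]+1≡i i) ([i-1]+d≡i+[d-1] i d)
      (proj₂ (condensation-≉0 (i -ℤ + 1) ((i -ℤ + 1) +ℤ d) (D≉0 (i -ℤ + 1))
        (≡.subst₂ Nonvanishing (≡.sym ([i-1]+1≡i i)) (≡.sym ([i-1]+d+1≡i+d i d)) (D≉0 i))))
    offset≉0 : ∀ d → OffsetNonvanishing d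
    offset≉0 = ℤ-induction OffsetNonvanishing
                           (λ i → ≡.subst (Nonvanishing i) (≡.sym (Int.+-identityʳ i)) (diagonal≉0 i)) up down

  cofactors-zero≉0 : ∀ i j → ¬ cofactors i j zero ≈ 0#
  cofactors-zero≉0 i j = contiguousMinors≉0 (i +ℤ + 1) (j +ℤ + 1) ∘ trans (sym (cofactors-zero i j))

  cofactors-last≉0 : ∀ i j → ¬ cofactors i j L ≈ 0#
  cofactors-last≉0 i j = x≉0∧y≉0⇒x*y≉0 (sign≉0 L) (contiguousMinors≉0 i (j +ℤ + 1)) ∘ trans (sym (cofactors-last i j))

  annihilatesWindow⇒follows-cofactors : ∀ v i j j′ → AnnihilatesWindow v i j → AnnihilatesWindow (cofactors i j′) i j →
                                        ∀ k → k ℕ.≤ r → Annihilates v i (j′ +ℤ + k)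
  annihilatesWindow⇒follows-cofactors v i j j′ v-ann g-ann k k≤r =
    proportional-annihilates v (cofactors i j′) (cofactors-last≉0 i j′)
      (window-proportional i j (contiguousMinors≉0 i j) v (cofactors i j′) v-ann g-ann)
      (λ a → M (interval K (suc r) i a) (j′ +ℤ + k)) (cofactors-annihilate i j′ k k≤r)

  annihilatesWindow-right : ∀ v i j → AnnihilatesWindow v i j → AnnihilatesWindow v i (j +ℤ + 1)
  annihilatesWindow-right v i j v-ann k k<r = ≡.subst (Annihilates v i) (i+[1+n]≡[i+1]+n j k)
    (annihilatesWindow⇒follows-cofactors v i j j v-ann (cofactors-annihilateWindow i j) (suc k) k<r)

  annihilatesWindow-left : ∀ v i j → AnnihilatesWindow v i j → AnnihilatesWindow v i (j -ℤ + 1)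
  annihilatesWindow-left v i j v-ann k k<r =
    annihilatesWindow⇒follows-cofactors v i j (j -ℤ + 1) v-ann (cofactors-annihilateNextWindow i j) k (ℕ.<⇒≤ k<r)

  rowRelation : ∀ i col → Annihilates (cofactors i (+ 0)) i col
  rowRelation i col = ≡.subst (Annihilates v i) (Int.+-identityʳ col) (windows col 0 (ℕ.s≤s ℕ.z≤n))
    where
    v = cofactors i (+ 0)
    windows : ∀ j → AnnihilatesWindow v i j
    windows = ℤ-induction (AnnihilatesWindow v i) (cofactors-annihilateWindow i (+ 0))
                          (annihilatesWindow-right v i) (annihilatesWindow-left v i)

  RowInSpan : ℤ → Set (c ⊔ ℓ)
  RowInSpan i = Σ (Fin r → Carrier) λ coeff → ∀ col → M i col ≈ sum (λ k → coeff k * M (+ Fin.toℕ k) col)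

  RowsInSpan : ℤ → Set (c ⊔ ℓ)
  RowsInSpan t = ∀ k → k ℕ.< r → RowInSpan (t +ℤ + k)

  inSpan-combination : ∀ {m} x (rows : Fin m → ℤ) (e : Fin m → Carrier) → (∀ a → RowInSpan (rows a)) →
                       (∀ col → M x col ≈ sum (λ a → e a * M (rows a) col)) → RowInSpan x
  inSpan-combination x rows e inSpan x≈ =
    (λ k → sum (λ a → e a * proj₁ (inSpan a) k)) ,
    combination-trans (M x) (M ∘ rows) (λ k → M (+ Fin.toℕ k)) e (proj₁ ∘ inSpan) x≈ (proj₂ ∘ inSpan)

  firstRows-inSpan : RowsInSpan (+ 0)
  firstRows-inSpan k k<r = unit , λ col → sym (begin
    sum (λ l → unit l * M (+ Fin.toℕ l) col)   ≈⟨ sum-single (λ l → unit l * M (+ Fin.toℕ l) col) p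
                                                             (λ l l≢p → trans (*-congʳ (unit-≢ l l≢p)) (zeroˡ _)) ⟩
    unit p * M (+ Fin.toℕ p) col               ≈⟨ *-cong unit-p (M-cong (≡.cong +_ (Fin.toℕ-fromℕ< k<r)) ≡.refl) ⟩
    1# * M (+ k) col                           ≈⟨ *-identityˡ _ ⟩
    M (+ 0 +ℤ + k) col                         ∎)
    where
    p = Fin.fromℕ< k<r
    unit : Fin r → Carrier
    unit l with l Fin.≟ p
    ... | yes _ = 1#
    ... | no _  = 0#
    unit-p : unit p ≈ 1#
    unit-p with p Fin.≟ p
    ... | yes _  = refl
    ... | no p≢p = contradiction ≡.refl p≢p
    unit-≢ : ∀ l → l ≢ p → unit l ≈ 0#
    unit-≢ l l≢p with l Fin.≟ p
    ... | yes l≡p = contradiction l≡p l≢p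
    ... | no _    = refl

  lastRow-inSpan : ∀ t → RowsInSpan t → RowInSpan (t +ℤ + r)
  lastRow-inSpan t inSpan =
    inSpan-combination (t +ℤ + r) (interval K r t) coeff (λ a → inSpan (Fin.toℕ a) (Fin.toℕ<n a)) lastRow≈
    where
    relation = dependentRow-inSpan (cofactors t (+ 0)) L (cofactors-last≉0 t (+ 0))
                                   (λ a → M (interval K (suc r) t a)) (rowRelation t)
    coeff : Fin r → Carrier
    coeff = proj₁ relation
    toℕ-punchIn-L : ∀ a → Fin.toℕ (Fin.punchIn L a) ≡ Fin.toℕ a
    toℕ-punchIn-L a = ≡.trans (≡.cong Fin.toℕ (punchIn-fromℕ a)) (Fin.toℕ-inject₁ a)
    lastRow≈ : ∀ col → M (t +ℤ + r) col ≈ sum (λ a → coeff a * M (interval K r t a) col)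
    lastRow≈ col = begin
      M (t +ℤ + r) col
        ≡⟨ ≡.cong (λ n → M (t +ℤ + n) col) (Fin.toℕ-fromℕ r) ⟨
      M (interval K (suc r) t L) col
        ≈⟨ proj₂ relation col ⟩
      sum (λ a → coeff a * M (interval K (suc r) t (Fin.punchIn L a)) col)
        ≈⟨ sum-cong-≋ (λ a → *-congˡ {coeff a} (reflexive (≡.cong (λ n → M (t +ℤ + n) col) (toℕ-punchIn-L a)))) ⟩
      sum (λ a → coeff a * M (interval K r t a) col) ∎

  previousRow-inSpan : ∀ t → RowsInSpan t → RowInSpan ((t -ℤ + 1) +ℤ + 0)
  previousRow-inSpan t inSpan =
    inSpan-combination _ (interval K r t) coeff (λ a → inSpan (Fin.toℕ a) (Fin.toℕ<n a)) previousRow≈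
    where
    relation = dependentRow-inSpan (cofactors (t -ℤ + 1) (+ 0)) zero (cofactors-zero≉0 (t -ℤ + 1) (+ 0))
                                   (λ a → M (interval K (suc r) (t -ℤ + 1) a)) (rowRelation (t -ℤ + 1))
    coeff : Fin r → Carrier
    coeff = proj₁ relation
    previousRow≈ : ∀ col → M ((t -ℤ + 1) +ℤ + 0) col ≈ sum (λ a → coeff a * M (interval K r t a) col)
    previousRow≈ col = trans (proj₂ relation col)
      (sum-cong-≋ (λ a → *-congˡ {coeff a} (reflexive (≡.cong (λ i → M i col) ([i-1]+[1+n]≡i+n t (Fin.toℕ a))))))

  rowsInSpan-up : ∀ t → RowsInSpan t → RowsInSpan (t +ℤ + 1)
  rowsInSpan-up t inSpan k k<r with ℕ.m≤n⇒m<n∨m≡n k<r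
  ... | inj₁ k+1<r = ≡.subst RowInSpan (i+[1+n]≡[i+1]+n t k) (inSpan (suc k) k+1<r)
  ... | inj₂ k+1≡r = ≡.subst RowInSpan (≡.trans (≡.cong (λ n → t +ℤ + n) (≡.sym k+1≡r)) (i+[1+n]≡[i+1]+n t k))
                             (lastRow-inSpan t inSpan)

  rowsInSpan-down : ∀ t → RowsInSpan t → RowsInSpan (t -ℤ + 1)
  rowsInSpan-down t inSpan zero    _     = previousRow-inSpan t inSpan
  rowsInSpan-down t inSpan (suc k) k+1<r =
    ≡.subst RowInSpan (≡.sym ([i-1]+[1+n]≡i+n t k)) (inSpan k (ℕ.<-trans (ℕ.n<1+n k) k+1<r))

  rowInSpan : ∀ i → RowInSpan i
  rowInSpan i = ≡.subst RowInSpan (Int.+-identityʳ i)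
                        (ℤ-induction RowsInSpan firstRows-inSpan rowsInSpan-up rowsInSpan-down i 0 (ℕ.s≤s ℕ.z≤n))

  rank≤r : RankAtMost K M r
  rank≤r = (λ k → M (+ Fin.toℕ k)) , λ i →
    let coeff , row≈ = rowInSpan i in
    coeff , λ col → trans (row≈ col) (sum≈sumFin (λ k → coeff k * M (+ Fin.toℕ k) col))

  minors≈0 : ∀ (ρ σ : Fin (suc r) → ℤ) → minor K M ρ σ ≈ 0#
  minors≈0 ρ σ = det-rowsInSpan (ℕ.n<1+n r) (λ a b → M (ρ a) (σ b)) (λ k b → M (+ Fin.toℕ k) (σ b))
                                (λ a → proj₁ (rowInSpan (ρ a))) (λ a b → proj₂ (rowInSpan (ρ a)) (σ b))

-- Monotonicity of the index maps is not needed: every (r+1)×(r+1) minor vanishes once the rank is at most r.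
proposition4p2 : ∀ {c ℓ : Level} (K : Field c ℓ) (M : ZMatrix K) (r : ℕ) → 1 ≤ r →
  (∀ (i j : ℤ) → Field._≈_ K (contiguousMinor K M (suc r) i j) (Field.0# K)) →
  (∀ (i : ℤ) → ¬ Field._≈_ K (contiguousMinor K M r i i) (Field.0# K)) →
  (∀ (i j : ℤ) → ¬ Field._≈_ K (contiguousMinor K M r i j) (Field.0# K))
  × RankAtMost K M r
  × (∀ (ρ σ : Fin (suc r) → ℤ) → StrictlyIncreasing K ρ → StrictlyIncreasing K σ →
       Field._≈_ K (minor K M ρ σ) (Field.0# K))
proposition4p2 K M (suc r′) (ℕ.s≤s ℕ.z≤n) vanish diagonal≉0 =
  contiguousMinors≉0 , rank≤r , λ ρ σ _ _ → minors≈0 ρ σ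
  where open ContiguousMinors K M r′ vanish diagonal≉0
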